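{- Let $\mathcal{M}=(\mathcal{E},\mathcal{I})$ be a matroid, $\mathcal{L}$ a finite set of labels and $\mathcal{C}$ a finite index set. If $(R,L)$ is an $\alpha$-uncontentious random labeled set for $\mathcal{M}$ and $\mathcal{L}$, and $C:\mathcal{E}\to\mathcal{C}$ is chosen uniformly at random independently of $(R,L)$, then $R\odot L\odot C=\{(e,L(e),C(e)):e\in R\}$ is an $\alpha$-uncontentious (unlabeled) random set for the matroid $\mathcal{M}\otimes\mathcal{L}\otimes\mathcal{C}$.
   Context: $\mathcal{M}\otimes\mathcal{L}\otimes\mathcal{C}$ is the matroid on ground set $\mathcal{E}\times\mathcal{L}\times\mathcal{C}$ obtained from $\mathcal{M}$ by replacing each element $e$ by $|\mathcal{L}||\mathcal{C}|$ parallel copies $(e,\ell,c)$; i.e., a set is independent iff it contains at most one copy of each element of $\mathcal{E}$ and the underlying set of elements of $\mathcal{E}$ is independent in $\mathcal{M}$. A labeled set is $(R,L)$ with $R\subseteq\mathcal{E}$, $L:R\to\mathcal{L}$. A labeled contention resolution map (LCRM) maps $(R,L)$ randomly to $T\in\mathcal{I}$ with $T\subseteq R$; it is $\alpha$-balanced for a distribution over labeled sets if $\Pr[e\in T\wedge L(e)=\ell]\ge\alpha\Pr[e\in R\wedge L(e)=\ell]$ for all $e,\ell$; a random labeled set is $\alpha$-uncontentious if an offline $\alpha$-balanced LCRM exists for its distribution. For an unlabeled random set $Q$ of a matroid with ground set $\mathcal{E}'$: a CRM is a randomized map $\phi$ to independent sets with $\phi(Q)\subseteq Q$, $\alpha$-balanced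 if $\Pr[i\in\phi(Q)]\ge\alpha\Pr[i\in Q]$ for all $i\in\mathcal{E}'$; $Q$ is $\alpha$-uncontentious if an offline $\alpha$-balanced CRM exists.
   Formalization: The probabilities of the random labeled set $(R,L)$, the probabilities with which both contention resolution maps choose their outputs, and α are taken rational. -}

module Defs where

open import Data.Nat as ℕ using (ℕ; zero; suc; _<_; _^_)
open import Data.Nat.Properties using (m^n≢0)
open import Data.Integer using (+_)
open import Data.Rational as ℚ using (ℚ; 0ℚ; 1ℚ; _+_; _*_; _≤_)
open import Data.Fin using (Fin) renaming (_≟_ to _≟ᶠ_)
open import Data.Fin.Subset using (Subset; _∈_; _∉_; _⊆_; ⊥; ⁅_⁆; _∪_; ∣_∣)
open import Data.Bool using (Bool; true; false; if_then_else_; _∧_) renaming (_≟_ to _≟ᵇ_)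
open import Data.Maybe using (Maybe; just; nothing; is-just)
open import Data.Maybe.Properties using (≡-dec)
open import Data.List using (List; []; _∷_; map; concatMap; foldr; allFin)
open import Data.List.Relation.Unary.All using (All)
open import Data.Product using (Σ; ∃; _×_; _,_; proj₁; proj₂)
open import Data.Vec using (lookup; tabulate)
open import Data.Vec.Functional as VF using ()
open import Data.Fin.Properties using (any?)
open import Relation.Nullary.Decidable using (⌊_⌋)
open import Relation.Binary.PropositionalEquality using (_≡_)

record Matroid (n : ℕ) : Set₁ where
  field
    Indep    : Subset n → Set
    indep-∅  : Indep ⊥
    indep-⊆  : ∀ {A B} → A ⊆ B → Indep B → Indep A
    exchange : ∀ {A B} → Indep A → Indep B → ∣ A ∣ < ∣ B ∣ →
               ∃ λ x → x ∈ B × x ∉ A × Indep (A ∪ ⁅ x ⁆)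
open Matroid public

sumℚ : List ℚ → ℚ
sumℚ = foldr _+_ 0ℚ

Weighted : Set → Set
Weighted A = List (A × ℚ)

record IsDist {A : Set} (D : Weighted A) : Set where
  field
    nonneg : All (λ xp → 0ℚ ≤ proj₂ xp) D
    total  : sumℚ (map proj₂ D) ≡ 1ℚ

𝔼 : {A : Set} → Weighted A → (A → ℚ) → ℚ
𝔼 D f = sumℚ (map (λ xp → proj₂ xp * f (proj₁ xp)) D)

indicator : Bool → ℚ
indicator b = if b then 1ℚ else 0ℚ

Pr : {A : Set} → Weighted A → (A → Bool) → ℚ
Pr D b = 𝔼 D (λ x → indicator (b x))

-- Labeled sets over ground set Fin n with labels Fin k:
-- (R , L) is encoded as x : Fin n → Maybe (Fin k) with
--   e ∈ R  iff  x e ≡ just (L e).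

LabeledSet : ℕ → ℕ → Set
LabeledSet n k = Fin n → Maybe (Fin k)

hasLabel : ∀ {n k} → LabeledSet n k → Fin n → Fin k → Bool
hasLabel x e ℓ = ⌊ ≡-dec _≟ᶠ_ (x e) (just ℓ) ⌋

support : ∀ {n k} → LabeledSet n k → Subset n
support {n} x = tabulate λ e → is-just (x e)

record LCRM {n} (M : Matroid n) (k : ℕ) : Set where
  field
    map-φ     : LabeledSet n k → Weighted (Subset n)
    isDist    : ∀ x → IsDist (map-φ x)
    indep-out : ∀ x → All (λ Tp → Indep M (proj₁ Tp)) (map-φ x)
    sub-out   : ∀ x → All (λ Tp → proj₁ Tp ⊆ support x) (map-φ x)
open LCRM public

LBalanced : ∀ {n k} {M : Matroid n} → ℚ → Weighted (LabeledSet n k) → LCRM M k → Set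
LBalanced {n} {k} α D φ =
  ∀ (e : Fin n) (ℓ : Fin k) →
    α * Pr D (λ x → hasLabel x e ℓ)
      ≤ 𝔼 D (λ x → Pr (map-φ φ x) (λ T → lookup T e ∧ hasLabel x e ℓ))

LUncontentious : ∀ {n} → Matroid n → (k : ℕ) → ℚ → Weighted (LabeledSet n k) → Set
LUncontentious M k α D = Σ (LCRM M k) λ φ → LBalanced α D φ

Ground : ℕ → ℕ → ℕ → Set
Ground n k c = Fin n × Fin k × Fin c

PSubset : ℕ → ℕ → ℕ → Set
PSubset n k c = Ground n k c → Bool

_⊆ₚ_ : ∀ {n k c} → PSubset n k c → PSubset n k c → Set
T ⊆ₚ S = ∀ i → T i ≡ true → S i ≡ true

underlying : ∀ {n k c} → PSubset n k c → Subset n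
underlying {n} {k} {c} S =
  tabulate λ e → ⌊ any? (λ ℓ → any? (λ d → S (e , ℓ , d) ≟ᵇ true)) ⌋

IndepProd : ∀ {n} (M : Matroid n) (k c : ℕ) → PSubset n k c → Set
IndepProd {n} M k c S =
  (∀ (e : Fin n) (ℓ ℓ' : Fin k) (d d' : Fin c) →
     S (e , ℓ , d) ≡ true → S (e , ℓ' , d') ≡ true → (ℓ ≡ ℓ') × (d ≡ d'))
  × Indep M (underlying S)

record CRM {n} (M : Matroid n) (k c : ℕ) : Set where
  field
    map-ψ     : PSubset n k c → Weighted (PSubset n k c)
    isDist    : ∀ S → IsDist (map-ψ S)
    indep-out : ∀ S → All (λ Tp → IndepProd M k c (proj₁ Tp)) (map-ψ S)
    sub-out   : ∀ S → All (λ Tp → proj₁ Tp ⊆ₚ S) (map-ψ S)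
open CRM public

Balanced : ∀ {n k c} {M : Matroid n} → ℚ → Weighted (PSubset n k c) → CRM M k c → Set
Balanced {n} {k} {c} α Q ψ =
  ∀ (i : Ground n k c) →
    α * Pr Q (λ S → S i) ≤ 𝔼 Q (λ S → Pr (map-ψ ψ S) (λ T → T i))

Uncontentious : ∀ {n} → Matroid n → (k c : ℕ) → ℚ → Weighted (PSubset n k c) → Set
Uncontentious M k c α Q = Σ (CRM M k c) λ ψ → Balanced α Q ψ

allFuns : ∀ (n c : ℕ) → List (Fin n → Fin c)
allFuns zero    c = (λ ()) ∷ []
allFuns (suc n) c =
  concatMap (λ j → map (λ f → j VF.∷ f) (allFuns n c)) (allFin c)

uniformFuns : ∀ (n c' : ℕ) → Weighted (Fin n → Fin (suc c'))
uniformFuns n c' =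
  map (λ f → f , ((+ 1) ℚ./ (suc c' ^ n)) {{m^n≢0 (suc c') n}}) (allFuns n (suc c'))

odot : ∀ {n k c} → LabeledSet n k → (Fin n → Fin c) → PSubset n k c
odot x C (e , ℓ , d) = hasLabel x e ℓ ∧ ⌊ C e ≟ᶠ d ⌋

odotDist : ∀ {n k} (c' : ℕ) → Weighted (LabeledSet n k) → Weighted (PSubset n k (suc c'))
odotDist {n} c' D =
  concatMap (λ xp → map (λ Cq → odot (proj₁ xp) (proj₁ Cq) , proj₂ xp * proj₂ Cq)
                        (uniformFuns n c'))
            D

-- Write S = R ⊙ L ⊙ C. Every e ∈ R has exactly one copy (e, L e, C e) in S, so S determines (R, L)
-- and the colours of R. Given an α-balanced LCRM φ, resolve S by running φ on the labeled set read
-- off S and keeping, for each selected e, its copy in S: the result is independent in M ⊗ L ⊗ C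
-- because its underlying set is the output of φ. The colour C e is uniform and independent of (R, L)
-- and of φ, so for every copy (e, ℓ, d) both the probability that it lies in S and the probability
-- that it is selected are the corresponding probabilities for (e, ℓ) times Pr[C e = d], and the
-- α-balance of φ carries over.

module Submission where

open import Defs
open import Data.Bool using (Bool; true; false; _∧_) renaming (_≟_ to _≟ᵇ_)
open import Data.Bool.Properties using (∧-assoc; ∧-conicalˡ; ∧-conicalʳ; ⇔→≡)
open import Data.Empty using (⊥-elim)
open import Data.Fin using (Fin) renaming (_≟_ to _≟ᶠ_)
open import Data.Fin.Properties using (any?)
open import Data.Fin.Subset using (Subset; _⊆_) renaming (_∈_ to _∈ₛ_)
import Data.Integer as ℤ
open import Data.List using ([]; _∷_; map; concatMap; _++_)
open import Data.List.Membership.Propositional using (_∈_)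
open import Data.List.Relation.Unary.All as All using (All; []; _∷_)
open import Data.List.Relation.Unary.All.Properties using (++⁺; map⁺)
open import Data.List.Relation.Unary.Any using (here; there)
open import Data.Maybe using (Maybe; just; nothing) renaming (map to mapₘ)
open import Data.Maybe.Properties using (just-injective; map-∘; map-id) renaming (≡-dec to ≡-decₘ)
open import Data.Nat using (ℕ; suc; _^_)
open import Data.Nat.Properties using (m^n≢0)
open import Data.Product using (_×_; _,_; proj₁; proj₂)
open import Data.Product.Properties using (,-injective) renaming (≡-dec to ≡-dec×)
open import Data.Rational as ℚ
  using (ℚ; 0ℚ; 1ℚ; _+_; _*_; _-_; _≤_; 1/_; ≢-nonZero; Positive; NonNegative; nonNegative)
open import Data.Rational.Properties
  using ( module ≤-Reasoning; ≤-refl; ≤-reflexive; ≤-antisym; +-assoc; +-identityˡ; +-identityʳ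
        ; +-inverseʳ; +-mono-≤; +-monoˡ-≤; +-monoʳ-≤; *-assoc; *-comm; *-identityˡ; *-identityʳ
        ; *-zeroˡ; *-zeroʳ; *-distribˡ-+; *-inverseʳ; *-monoʳ-≤-nonNeg; nonNegative⁻¹
        ; nonNeg*nonNeg⇒nonNeg; nonNeg∧nonZero⇒pos; pos⇒nonNeg; pos⇒nonZero; 1/pos⇒pos
        ; normalize-nonNeg )
  renaming (_≟_ to _≟ℚ_)
open import Data.Rational.Solver using (module +-*-Solver)
open import Data.Sum using (_⊎_; inj₁; inj₂)
open import Data.Vec using (lookup)
open import Data.Vec.Properties using ([]=⇒lookup; lookup⇒[]=; lookup∘tabulate)
import Data.Vec.Functional.Relation.Binary.Pointwise.Properties as Pointwise using (decSetoid)
open import Function using (id; _∘_; _⇔_; mk⇔; Equivalence)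
open import Function.Construct.Composition using (_⇔-∘_)
open import Function.Construct.Symmetry using (⇔-sym)
open import Level using (0ℓ)
open import Relation.Binary.Bundles using (DecSetoid)
open import Relation.Binary.Definitions using (DecidableEquality)
open import Relation.Binary.PropositionalEquality
import Relation.Binary.PropositionalEquality.Properties as ≡ using (decSetoid)
open import Relation.Nullary using (Dec; yes; no)
open import Relation.Nullary.Decidable using (⌊_⌋)

open +-*-Solver

⌊⌋≡true⇔ : {P : Set} (p? : Dec P) → ⌊ p? ⌋ ≡ true ⇔ P
⌊⌋≡true⇔ (yes p)  = mk⇔ (λ _ → p) (λ _ → refl)
⌊⌋≡true⇔ (no ¬p) = mk⇔ (λ ()) (λ p → ⊥-elim (¬p p))

⌊⌋-cong : {P Q : Set} → P ⇔ Q → (p? : Dec P) (q? : Dec Q) → ⌊ p? ⌋ ≡ ⌊ q? ⌋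
⌊⌋-cong P⇔Q (yes _)  (yes _)  = refl
⌊⌋-cong P⇔Q (no _)   (no _)   = refl
⌊⌋-cong P⇔Q (yes p)  (no ¬q) = ⊥-elim (¬q (Equivalence.to P⇔Q p))
⌊⌋-cong P⇔Q (no ¬p) (yes q)  = ⊥-elim (¬p (Equivalence.from P⇔Q q))

mapₘ-pair≡just⇔ : {A B : Set} (m : Maybe A) {b b′ : B} {a : A} →
                  mapₘ (_, b) m ≡ just (a , b′) ⇔ (m ≡ just a × b ≡ b′)
mapₘ-pair≡just⇔ nothing  = mk⇔ (λ ()) (λ { (() , _) })
mapₘ-pair≡just⇔ (just _) = mk⇔ (λ { refl → refl , refl }) (λ { (refl , refl) → refl })

*-nonNeg : ∀ {p q} → 0ℚ ≤ p → 0ℚ ≤ q → 0ℚ ≤ p * q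
*-nonNeg {p} {q} p≥0 q≥0 =
  nonNegative⁻¹ (p * q) {{nonNeg*nonNeg⇒nonNeg p {{nonNegative p≥0}} q {{nonNegative q≥0}}}}

indicator-nonNeg : ∀ b → 0ℚ ≤ indicator b
indicator-nonNeg true  = nonNegative⁻¹ 1ℚ
indicator-nonNeg false = ≤-refl

indicator-∧ : ∀ a b → indicator (a ∧ b) ≡ indicator a * indicator b
indicator-∧ true  b = sym (*-identityˡ _)
indicator-∧ false b = sym (*-zeroˡ (indicator b))

-- total inverse, with the junk value 0ℚ ⁻¹ = 0ℚ
_⁻¹ : ℚ → ℚ
q ⁻¹ with q ≟ℚ 0ℚ
... | yes _   = 0ℚ
... | no q≢0 = (1/ q) {{≢-nonZero q≢0}}

⁻¹-nonNeg : ∀ {q} → 0ℚ ≤ q → 0ℚ ≤ q ⁻¹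
⁻¹-nonNeg {q} q≥0 with q ≟ℚ 0ℚ
... | yes _   = ≤-refl
... | no q≢0 = 1/q≥0
  where
  instance
    q>0 : Positive q
    q>0 = nonNeg∧nonZero⇒pos q {{nonNegative q≥0}} {{≢-nonZero q≢0}}
  1/q≥0 : 0ℚ ≤ (1/ q) {{pos⇒nonZero q}}
  1/q≥0 = nonNegative⁻¹ _ {{pos⇒nonNeg ((1/ q) {{pos⇒nonZero q}}) {{1/pos⇒pos q}}}}

≡0⊎*⁻¹≡1 : ∀ q → q ≡ 0ℚ ⊎ q * q ⁻¹ ≡ 1ℚ
≡0⊎*⁻¹≡1 q with q ≟ℚ 0ℚ
... | yes q≡0 = inj₁ q≡0
... | no q≢0 = inj₂ (*-inverseʳ q {{≢-nonZero q≢0}})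

1-*⁻¹-nonNeg : ∀ q → 0ℚ ≤ 1ℚ - q * q ⁻¹
1-*⁻¹-nonNeg q with ≡0⊎*⁻¹≡1 q
... | inj₁ refl = nonNegative⁻¹ 1ℚ
... | inj₂ q*q⁻¹≡1 = ≤-reflexive (sym (trans (cong (1ℚ -_) q*q⁻¹≡1) (+-inverseʳ 1ℚ)))

NonNeg : {A : Set} → Weighted A → Set
NonNeg = All (λ ap → 0ℚ ≤ proj₂ ap)

module _ {A : Set} where

  𝔼-cong : (D : Weighted A) {f g : A → ℚ} → (∀ a → f a ≡ g a) → 𝔼 D f ≡ 𝔼 D g
  𝔼-cong []            f≗g = refl
  𝔼-cong ((a , p) ∷ D) f≗g = cong₂ _+_ (cong (p *_) (f≗g a)) (𝔼-cong D f≗g)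

  𝔼-cong-∈ : (D : Weighted A) {f g : A → ℚ} →
             (∀ {a p} → (a , p) ∈ D → p * f a ≡ p * g a) → 𝔼 D f ≡ 𝔼 D g
  𝔼-cong-∈ []            eq = refl
  𝔼-cong-∈ ((a , p) ∷ D) eq = cong₂ _+_ (eq (here refl)) (𝔼-cong-∈ D (eq ∘ there))

  𝔼-zero : (D : Weighted A) → 𝔼 D (λ _ → 0ℚ) ≡ 0ℚ
  𝔼-zero []            = refl
  𝔼-zero ((a , p) ∷ D) = trans (cong₂ _+_ (*-zeroʳ p) (𝔼-zero D)) (+-identityˡ 0ℚ)

  𝔼-+ : (D : Weighted A) (f g : A → ℚ) → 𝔼 D (λ a → f a + g a) ≡ 𝔼 D f + 𝔼 D g
  𝔼-+ []            f g = sym (+-identityˡ 0ℚ)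
  𝔼-+ ((a , p) ∷ D) f g = trans (cong (p * (f a + g a) +_) (𝔼-+ D f g))
    (solve 5 (λ p x y u v → p :* (x :+ y) :+ (u :+ v) := (p :* x :+ u) :+ (p :* y :+ v))
           refl p (f a) (g a) (𝔼 D f) (𝔼 D g))

  𝔼-*ˡ : (D : Weighted A) (c : ℚ) (f : A → ℚ) → 𝔼 D (λ a → c * f a) ≡ c * 𝔼 D f
  𝔼-*ˡ []            c f = sym (*-zeroʳ c)
  𝔼-*ˡ ((a , p) ∷ D) c f = trans (cong (p * (c * f a) +_) (𝔼-*ˡ D c f))
    (solve 4 (λ p c x e → p :* (c :* x) :+ c :* e := c :* (p :* x :+ e)) refl p c (f a) (𝔼 D f))

  𝔼-*ʳ : (D : Weighted A) (c : ℚ) (f : A → ℚ) → 𝔼 D (λ a → f a * c) ≡ 𝔼 D f * c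
  𝔼-*ʳ D c f = trans (𝔼-cong D (λ a → *-comm (f a) c)) (trans (𝔼-*ˡ D c f) (*-comm c _))

  𝔼-nonNeg : {D : Weighted A} {f : A → ℚ} → NonNeg D → (∀ a → 0ℚ ≤ f a) → 0ℚ ≤ 𝔼 D f
  𝔼-nonNeg []          f≥0 = ≤-refl
  𝔼-nonNeg {(a , p) ∷ D} (p≥0 ∷ D≥0) f≥0 =
    +-mono-≤ {0ℚ} {_} {0ℚ} (*-nonNeg p≥0 (f≥0 a)) (𝔼-nonNeg D≥0 f≥0)

  term≤𝔼 : {D : Weighted A} {f : A → ℚ} → NonNeg D → (∀ a → 0ℚ ≤ f a) →
           ∀ {a p} → (a , p) ∈ D → p * f a ≤ 𝔼 D f
  term≤𝔼 {(a , p) ∷ D} {f} (_ ∷ D≥0) f≥0 (here refl) = begin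
    p * f a             ≡⟨ sym (+-identityʳ _) ⟩
    p * f a + 0ℚ        ≤⟨ +-monoʳ-≤ (p * f a) (𝔼-nonNeg D≥0 f≥0) ⟩
    p * f a + 𝔼 D f     ∎
    where open ≤-Reasoning
  term≤𝔼 {(b , q) ∷ D} {f} (q≥0 ∷ D≥0) f≥0 {a} {p} (there a∈D) = begin
    p * f a             ≤⟨ term≤𝔼 D≥0 f≥0 a∈D ⟩
    𝔼 D f               ≡⟨ sym (+-identityˡ _) ⟩
    0ℚ + 𝔼 D f          ≤⟨ +-monoˡ-≤ (𝔼 D f) (*-nonNeg q≥0 (f≥0 b)) ⟩
    q * f b + 𝔼 D f     ∎
    where open ≤-Reasoning

  weight≤Pr : {D : Weighted A} {E : A → Bool} → NonNeg D →
              ∀ {a p} → (a , p) ∈ D → E a ≡ true → p ≤ Pr D E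
  weight≤Pr {D} {E} D≥0 {a} {p} a∈D Ea = begin
    p                    ≡⟨ sym (*-identityʳ p) ⟩
    p * 1ℚ               ≡⟨ cong (λ b → p * indicator b) (sym Ea) ⟩
    p * indicator (E a)  ≤⟨ term≤𝔼 D≥0 (indicator-nonNeg ∘ E) a∈D ⟩
    Pr D E               ∎
    where open ≤-Reasoning

  totalWeight≡𝔼1 : (D : Weighted A) → sumℚ (map proj₂ D) ≡ 𝔼 D (λ _ → 1ℚ)
  totalWeight≡𝔼1 []            = refl
  totalWeight≡𝔼1 ((a , p) ∷ D) = cong₂ _+_ (sym (*-identityʳ p)) (totalWeight≡𝔼1 D)

  𝔼-++ : (D D′ : Weighted A) (f : A → ℚ) → 𝔼 (D ++ D′) f ≡ 𝔼 D f + 𝔼 D′ f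
  𝔼-++ []            D′ f = sym (+-identityˡ _)
  𝔼-++ ((a , p) ∷ D) D′ f =
    trans (cong (p * f a +_) (𝔼-++ D D′ f)) (sym (+-assoc (p * f a) (𝔼 D f) (𝔼 D′ f)))

  Pr-∧ʳ : (D : Weighted A) (b : A → Bool) (c : Bool) → Pr D (λ a → b a ∧ c) ≡ Pr D b * indicator c
  Pr-∧ʳ D b c = trans (𝔼-cong D (λ a → indicator-∧ (b a) c)) (𝔼-*ʳ D (indicator c) _)

  Pr-∧ˡ : (D : Weighted A) (b : Bool) (c : A → Bool) → Pr D (λ a → b ∧ c a) ≡ indicator b * Pr D c
  Pr-∧ˡ D b c = trans (𝔼-cong D (λ a → indicator-∧ b (c a))) (𝔼-*ˡ D (indicator b) _)

𝔼-swap : {A B : Set} (D : Weighted A) (D′ : Weighted B) (g : A → B → ℚ) →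
         𝔼 D (λ a → 𝔼 D′ (g a)) ≡ 𝔼 D′ (λ b → 𝔼 D (λ a → g a b))
𝔼-swap []            D′ g = sym (𝔼-zero D′)
𝔼-swap ((a , p) ∷ D) D′ g =
  trans (cong₂ _+_ (sym (𝔼-*ˡ D′ p (g a))) (𝔼-swap D D′ g)) (sym (𝔼-+ D′ _ _))

module _ {A : Set} where

  reweight : (A → ℚ) → Weighted A → Weighted A
  reweight w = map (λ ap → proj₁ ap , proj₂ ap * w (proj₁ ap))

  𝔼-reweight : (w : A → ℚ) (D : Weighted A) (f : A → ℚ) →
               𝔼 (reweight w D) f ≡ 𝔼 D (λ a → w a * f a)
  𝔼-reweight w []            f = refl
  𝔼-reweight w ((a , p) ∷ D) f = cong₂ _+_ (*-assoc p (w a) (f a)) (𝔼-reweight w D f)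

  reweight-nonNeg : {w : A → ℚ} {D : Weighted A} → (∀ a → 0ℚ ≤ w a) → NonNeg D → NonNeg (reweight w D)
  reweight-nonNeg w≥0 D≥0 = map⁺ (All.map (λ {ap} p≥0 → *-nonNeg p≥0 (w≥0 (proj₁ ap))) D≥0)

  -- D conditioned on E (all weights vanish when Pr D E = 0)
  _∣_ : Weighted A → (A → Bool) → Weighted A
  D ∣ E = reweight (λ a → indicator (E a) * Pr D E ⁻¹) D

  𝔼-∣ : (D : Weighted A) (E : A → Bool) (f : A → ℚ) →
        𝔼 (D ∣ E) f ≡ 𝔼 D (λ a → indicator (E a) * f a) * Pr D E ⁻¹
  𝔼-∣ D E f = begin
    𝔼 (D ∣ E) f                                       ≡⟨ 𝔼-reweight _ D f ⟩
    𝔼 D (λ a → (indicator (E a) * Pr D E ⁻¹) * f a)   ≡⟨ 𝔼-cong D (λ a → swap (indicator (E a)) (f a)) ⟩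
    𝔼 D (λ a → (indicator (E a) * f a) * Pr D E ⁻¹)   ≡⟨ 𝔼-*ʳ D _ _ ⟩
    𝔼 D (λ a → indicator (E a) * f a) * Pr D E ⁻¹     ∎
    where
    open ≡-Reasoning
    swap : ∀ x y → (x * Pr D E ⁻¹) * y ≡ (x * y) * Pr D E ⁻¹
    swap x y = solve 3 (λ x y w → (x :* w) :* y := (x :* y) :* w) refl x y (Pr D E ⁻¹)

  ∣-nonNeg : {D : Weighted A} (E : A → Bool) → NonNeg D → NonNeg (D ∣ E)
  ∣-nonNeg E D≥0 = reweight-nonNeg
    (λ a → *-nonNeg (indicator-nonNeg (E a)) (⁻¹-nonNeg (𝔼-nonNeg D≥0 (indicator-nonNeg ∘ E)))) D≥0

  𝔼-∣-1 : (D : Weighted A) (E : A → Bool) → 𝔼 (D ∣ E) (λ _ → 1ℚ) ≡ Pr D E * Pr D E ⁻¹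
  𝔼-∣-1 D E = trans (𝔼-∣ D E _) (cong (_* Pr D E ⁻¹) (𝔼-cong D (λ a → *-identityʳ _)))

  𝔼-∣-cong : (D : Weighted A) {E E′ : A → Bool} {f g : A → ℚ} →
             (∀ a → E a ≡ E′ a) → (∀ a → E a ≡ true → f a ≡ g a) → 𝔼 (D ∣ E) f ≡ 𝔼 (D ∣ E′) g
  𝔼-∣-cong D {E} {E′} {f} {g} E≗E′ f≗g = begin
    𝔼 (D ∣ E) f                                      ≡⟨ 𝔼-∣ D E f ⟩
    𝔼 D (λ a → indicator (E a) * f a) * Pr D E ⁻¹
      ≡⟨ cong₂ (λ x y → x * y ⁻¹) (𝔼-cong D on-E) (𝔼-cong D (cong indicator ∘ E≗E′)) ⟩
    𝔼 D (λ a → indicator (E′ a) * g a) * Pr D E′ ⁻¹  ≡⟨ sym (𝔼-∣ D E′ g) ⟩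
    𝔼 (D ∣ E′) g                                     ∎
    where
    open ≡-Reasoning
    on-E : ∀ a → indicator (E a) * f a ≡ indicator (E′ a) * g a
    on-E a with E a in Ea
    ... | true  rewrite sym (E≗E′ a) | Ea = cong (1ℚ *_) (f≗g a Ea)
    ... | false rewrite sym (E≗E′ a) | Ea = trans (*-zeroˡ (f a)) (sym (*-zeroˡ (g a)))

bindWith : {A B X : Set} → (A → B → X) → Weighted A → (A → Weighted B) → Weighted X
bindWith h D K =
  concatMap (λ ap → map (λ bq → h (proj₁ ap) (proj₁ bq) , proj₂ ap * proj₂ bq) (K (proj₁ ap))) D

module _ {A B X : Set} (h : A → B → X) (K : A → Weighted B) where

  private
    𝔼-scaled : (a : A) (p : ℚ) (L : Weighted B) (f : X → ℚ) →
               𝔼 (map (λ bq → h a (proj₁ bq) , p * proj₂ bq) L) f ≡ p * 𝔼 L (f ∘ h a)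
    𝔼-scaled a p []            f = sym (*-zeroʳ p)
    𝔼-scaled a p ((b , q) ∷ L) f = trans (cong₂ _+_ (*-assoc p q (f (h a b))) (𝔼-scaled a p L f))
                                          (sym (*-distribˡ-+ p _ _))

  𝔼-bindWith : (D : Weighted A) (f : X → ℚ) → 𝔼 (bindWith h D K) f ≡ 𝔼 D (λ a → 𝔼 (K a) (f ∘ h a))
  𝔼-bindWith []            f = refl
  𝔼-bindWith ((a , p) ∷ D) f =
    trans (𝔼-++ (map _ (K a)) (bindWith h D K) f) (cong₂ _+_ (𝔼-scaled a p (K a) f) (𝔼-bindWith D f))

  bindWith-nonNeg : {D : Weighted A} → NonNeg D → (∀ a → NonNeg (K a)) → NonNeg (bindWith h D K)
  bindWith-nonNeg []          K≥0 = []
  bindWith-nonNeg (p≥0 ∷ D≥0) K≥0 =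
    ++⁺ (map⁺ (All.map (*-nonNeg p≥0) (K≥0 _))) (bindWith-nonNeg D≥0 K≥0)

  bindWith-All : (P : X → Set) (D : Weighted A) →
                 (∀ a → All (λ bq → P (h a (proj₁ bq))) (K a)) → All (P ∘ proj₁) (bindWith h D K)
  bindWith-All P []            PK = []
  bindWith-All P ((a , p) ∷ D) PK = ++⁺ (map⁺ (PK a)) (bindWith-All P D PK)

module Classes (S : DecSetoid 0ℓ 0ℓ) where
  open DecSetoid S using (_≈_; _≟_)
    renaming (Carrier to A; refl to ≈-refl; sym to ≈-sym; trans to ≈-trans)

  _≈ᵇ_ : A → A → Bool
  x ≈ᵇ y = ⌊ x ≟ y ⌋

  ≈ᵇ⇒≈ : ∀ {x y} → x ≈ᵇ y ≡ true → x ≈ y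
  ≈ᵇ⇒≈ {x} {y} = Equivalence.to (⌊⌋≡true⇔ (x ≟ y))

  ≈ᵇ-refl : ∀ x → x ≈ᵇ x ≡ true
  ≈ᵇ-refl x = Equivalence.from (⌊⌋≡true⇔ (x ≟ x)) ≈-refl

  ≈ᵇ-sym : ∀ x y → x ≈ᵇ y ≡ y ≈ᵇ x
  ≈ᵇ-sym x y = ⌊⌋-cong (mk⇔ ≈-sym ≈-sym) (x ≟ y) (y ≟ x)

  ≈ᵇ-respˡ : ∀ {x y} → x ≈ y → ∀ z → x ≈ᵇ z ≡ y ≈ᵇ z
  ≈ᵇ-respˡ {x} {y} x≈y z = ⌊⌋-cong (mk⇔ (≈-trans (≈-sym x≈y)) (≈-trans x≈y)) (x ≟ z) (y ≟ z)

  module _ (D : Weighted A) where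

    classMass : A → ℚ
    classMass x = Pr D (x ≈ᵇ_)

    classWeight-sym : ∀ x y → indicator (x ≈ᵇ y) * classMass x ⁻¹ ≡ indicator (y ≈ᵇ x) * classMass y ⁻¹
    classWeight-sym x y rewrite ≈ᵇ-sym x y with y ≈ᵇ x in y≈ᵇx
    ... | true  = cong (λ m → 1ℚ * m ⁻¹)
                       (𝔼-cong D (cong indicator ∘ ≈ᵇ-respˡ (≈-sym (≈ᵇ⇒≈ y≈ᵇx))))
    ... | false = trans (*-zeroˡ (classMass x ⁻¹)) (sym (*-zeroˡ (classMass y ⁻¹)))

    𝔼-tower : NonNeg D → (f : A → ℚ) → 𝔼 D (λ x → 𝔼 (D ∣ (x ≈ᵇ_)) f) ≡ 𝔼 D f
    𝔼-tower D≥0 f = begin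
      𝔼 D (λ x → 𝔼 (D ∣ (x ≈ᵇ_)) f)
        ≡⟨ 𝔼-cong D (λ x → trans (𝔼-∣ D (x ≈ᵇ_) f) (sym (𝔼-*ʳ D _ _))) ⟩
      𝔼 D (λ x → 𝔼 D (λ y → (indicator (x ≈ᵇ y) * f y) * classMass x ⁻¹))
        ≡⟨ 𝔼-cong D (λ x → 𝔼-cong D (reassoc x)) ⟩
      𝔼 D (λ x → 𝔼 D (λ y → indicator (y ≈ᵇ x) * (classMass y ⁻¹ * f y)))
        ≡⟨ 𝔼-swap D D _ ⟩
      𝔼 D (λ y → 𝔼 D (λ x → indicator (y ≈ᵇ x) * (classMass y ⁻¹ * f y)))
        ≡⟨ 𝔼-cong D (λ y → 𝔼-*ʳ D _ _) ⟩
      𝔼 D (λ y → classMass y * (classMass y ⁻¹ * f y))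
        ≡⟨ 𝔼-cong-∈ D cancel ⟩
      𝔼 D f ∎
      where
      open ≡-Reasoning
      reassoc : ∀ x y → (indicator (x ≈ᵇ y) * f y) * classMass x ⁻¹
                        ≡ indicator (y ≈ᵇ x) * (classMass y ⁻¹ * f y)
      reassoc x y = begin
        (indicator (x ≈ᵇ y) * f y) * classMass x ⁻¹
          ≡⟨ solve 3 (λ i v w → (i :* v) :* w := (i :* w) :* v) refl
                     (indicator (x ≈ᵇ y)) (f y) (classMass x ⁻¹) ⟩
        (indicator (x ≈ᵇ y) * classMass x ⁻¹) * f y
          ≡⟨ cong (_* f y) (classWeight-sym x y) ⟩
        (indicator (y ≈ᵇ x) * classMass y ⁻¹) * f y
          ≡⟨ *-assoc (indicator (y ≈ᵇ x)) (classMass y ⁻¹) (f y) ⟩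
        indicator (y ≈ᵇ x) * (classMass y ⁻¹ * f y)   ∎
      -- the class of a point of D has mass at least its weight, so a null class is null in D
      cancel : ∀ {y p} → (y , p) ∈ D → p * (classMass y * (classMass y ⁻¹ * f y)) ≡ p * f y
      cancel {y} {p} y∈D with ≡0⊎*⁻¹≡1 (classMass y)
      ... | inj₂ m*m⁻¹≡1 = cong (p *_) (begin
        classMass y * (classMass y ⁻¹ * f y)   ≡⟨ sym (*-assoc (classMass y) (classMass y ⁻¹) (f y)) ⟩
        (classMass y * classMass y ⁻¹) * f y   ≡⟨ cong (_* f y) m*m⁻¹≡1 ⟩
        1ℚ * f y                               ≡⟨ *-identityˡ (f y) ⟩
        f y                                    ∎)
      ... | inj₁ m≡0 = subst (λ p → p * r ≡ p * f y) (sym p≡0) (trans (*-zeroˡ r) (sym (*-zeroˡ (f y))))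
        where
        r : ℚ
        r = classMass y * (classMass y ⁻¹ * f y)
        p≡0 : p ≡ 0ℚ
        p≡0 = ≤-antisym (subst (p ≤_) m≡0 (weight≤Pr D≥0 y∈D (≈ᵇ-refl y))) (All.lookup D≥0 y∈D)

hasLabel-resp : ∀ {n k} {x y : LabeledSet n k} e ℓ → x e ≡ y e → hasLabel x e ℓ ≡ hasLabel y e ℓ
hasLabel-resp e ℓ = cong (λ m → ⌊ ≡-decₘ _≟ᶠ_ m (just ℓ) ⌋)

module _ {n k c : ℕ} where

  ∈-odot : ∀ (x : LabeledSet n k) (C : Fin n → Fin c) {e ℓ d} →
           odot x C (e , ℓ , d) ≡ true ⇔ (x e ≡ just ℓ × C e ≡ d)
  ∈-odot x C {e} {ℓ} {d} = mk⇔
    (λ h → Equivalence.to (⌊⌋≡true⇔ (≡-decₘ _≟ᶠ_ (x e) (just ℓ))) (∧-conicalˡ _ _ h)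
         , Equivalence.to (⌊⌋≡true⇔ (C e ≟ᶠ d)) (∧-conicalʳ _ _ h))
    (λ (xe≡ℓ , Ce≡d) → cong₂ _∧_ (Equivalence.from (⌊⌋≡true⇔ (≡-decₘ _≟ᶠ_ (x e) (just ℓ))) xe≡ℓ)
                                  (Equivalence.from (⌊⌋≡true⇔ (C e ≟ᶠ d)) Ce≡d))

  underlying-⊆ : ∀ {S : PSubset n k c} {X : Subset n} →
                 (∀ {e ℓ d} → S (e , ℓ , d) ≡ true → e ∈ₛ X) → underlying S ⊆ X
  underlying-⊆ {S} S⇒X {e} e∈S with Equivalence.to (⌊⌋≡true⇔ _)
    (trans (sym (lookup∘tabulate _ e)) ([]=⇒lookup e∈S))
  ... | _ , _ , S∋ = S⇒X S∋

  chosenCopy : PSubset n k c → Fin n → Maybe (Fin k × Fin c)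
  chosenCopy S e with any? (λ ℓ → any? (λ d → S (e , ℓ , d) ≟ᵇ true))
  ... | yes (ℓ , d , _) = just (ℓ , d)
  ... | no _            = nothing

  chosenCopy-sound : ∀ S e {ℓ d} → chosenCopy S e ≡ just (ℓ , d) → S (e , ℓ , d) ≡ true
  chosenCopy-sound S e eq with any? (λ ℓ → any? (λ d → S (e , ℓ , d) ≟ᵇ true)) | eq
  ... | yes (_ , _ , S∋) | refl = S∋

  chosenCopy-odot : ∀ x C e → chosenCopy (odot x C) e ≡ mapₘ (_, C e) (x e)
  chosenCopy-odot x C e with any? (λ ℓ → any? (λ d → odot x C (e , ℓ , d) ≟ᵇ true))
  ... | yes (ℓ , d , ∈odot) with (xe≡ℓ , Ce≡d) ← Equivalence.to (∈-odot x C) ∈odot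
                            rewrite xe≡ℓ | Ce≡d = refl
  ... | no ∉odot = cong (mapₘ (_, C e)) (sym (unlabelled (x e) refl))
    where
    unlabelled : ∀ m → x e ≡ m → m ≡ nothing
    unlabelled nothing  _    = refl
    unlabelled (just ℓ) xe≡ℓ = ⊥-elim (∉odot (ℓ , C e , Equivalence.from (∈-odot x C) (xe≡ℓ , refl)))

  labelsOf : PSubset n k c → LabeledSet n k
  labelsOf S e = mapₘ proj₁ (chosenCopy S e)

  labelsOf-odot : ∀ x C e → labelsOf (odot x C) e ≡ x e
  labelsOf-odot x C e = begin
    mapₘ proj₁ (chosenCopy (odot x C) e)   ≡⟨ cong (mapₘ proj₁) (chosenCopy-odot x C e) ⟩
    mapₘ proj₁ (mapₘ (_, C e) (x e))       ≡⟨ sym (map-∘ (x e)) ⟩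
    mapₘ id (x e)                          ≡⟨ map-id (x e) ⟩
    x e                                    ∎
    where open ≡-Reasoning

  _≟ᶜ_ : DecidableEquality (Maybe (Fin k × Fin c))
  _≟ᶜ_ = ≡-decₘ (≡-dec× _≟ᶠ_ _≟ᶠ_)

  chosenCopies : PSubset n k c → Subset n → PSubset n k c
  chosenCopies S T (e , ℓ , d) = lookup T e ∧ ⌊ chosenCopy S e ≟ᶜ just (ℓ , d) ⌋

  ∈-chosenCopies⁻ : ∀ S T {e ℓ d} → chosenCopies S T (e , ℓ , d) ≡ true →
                    lookup T e ≡ true × chosenCopy S e ≡ just (ℓ , d)
  ∈-chosenCopies⁻ S T h = ∧-conicalˡ _ _ h , Equivalence.to (⌊⌋≡true⇔ (_ ≟ᶜ _)) (∧-conicalʳ _ _ h)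

  chosenCopies-⊆ : ∀ S T → chosenCopies S T ⊆ₚ S
  chosenCopies-⊆ S T (e , ℓ , d) h = chosenCopy-sound S e (proj₂ (∈-chosenCopies⁻ S T h))

  chosenCopies-indep : (M : Matroid n) → ∀ S {T} → Indep M T → IndepProd M k c (chosenCopies S T)
  chosenCopies-indep M S {T} T-indep = oneCopy , indep-⊆ M (underlying-⊆ inT) T-indep
    where
    chosen : ∀ {e ℓ d} → chosenCopies S T (e , ℓ , d) ≡ true → chosenCopy S e ≡ just (ℓ , d)
    chosen = proj₂ ∘ ∈-chosenCopies⁻ S T
    oneCopy : ∀ e ℓ ℓ′ d d′ → chosenCopies S T (e , ℓ , d) ≡ true →
              chosenCopies S T (e , ℓ′ , d′) ≡ true → ℓ ≡ ℓ′ × d ≡ d′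
    oneCopy e ℓ ℓ′ d d′ h h′ =
      ,-injective (just-injective (trans (sym (chosen h)) (chosen h′)))
    inT : ∀ {e ℓ d} → chosenCopies S T (e , ℓ , d) ≡ true → e ∈ₛ T
    inT h = lookup⇒[]= _ T (proj₁ (∈-chosenCopies⁻ S T h))

  ∅-indep : (M : Matroid n) → IndepProd M k c (λ _ → false)
  ∅-indep M = (λ _ _ _ _ _ ()) , indep-⊆ M (underlying-⊆ (λ ())) (indep-∅ M)

  chosenCopies-odot : ∀ x C T e ℓ d →
                      chosenCopies (odot x C) T (e , ℓ , d) ≡ lookup T e ∧ odot x C (e , ℓ , d)
  chosenCopies-odot x C T e ℓ d = cong (lookup T e ∧_) (⇔→≡
    (⇔-sym (∈-odot x C) ⇔-∘ (mapₘ-pair≡just⇔ (x e) ⇔-∘ (≡just⇔ ⇔-∘ ⌊⌋≡true⇔ (_ ≟ᶜ _)))))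
    where
    ≡just⇔ : chosenCopy (odot x C) e ≡ just (ℓ , d) ⇔ mapₘ (_, C e) (x e) ≡ just (ℓ , d)
    ≡just⇔ rewrite chosenCopy-odot x C e = mk⇔ id id

uniformFuns-nonNeg : ∀ n c′ → NonNeg (uniformFuns n c′)
uniformFuns-nonNeg n c′ = map⁺ (All.universal (λ _ → nonNegative⁻¹ _ {{weight≥0}}) (allFuns n (suc c′)))
  where
  weight≥0 : NonNegative (((ℤ.+ 1) ℚ./ (suc c′ ^ n)) {{m^n≢0 (suc c′) n}})
  weight≥0 = normalize-nonNeg 1 (suc c′ ^ n) {{m^n≢0 (suc c′) n}}

module _ {n k c′ : ℕ} (D : Weighted (LabeledSet n k)) where

  𝔼-odotDist : (F : PSubset n k (suc c′) → ℚ) →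
               𝔼 (odotDist c′ D) F ≡ 𝔼 D (λ x → 𝔼 (uniformFuns n c′) (λ C → F (odot x C)))
  𝔼-odotDist = 𝔼-bindWith odot (λ _ → uniformFuns n c′) D

labeledSetoid : ℕ → ℕ → DecSetoid 0ℓ 0ℓ
labeledSetoid n k = Pointwise.decSetoid (≡.decSetoid (≡-decₘ (_≟ᶠ_ {k}))) n

module LiftedCRM {n k c′ : ℕ} (M : Matroid n) (D : Weighted (LabeledSet n k)) (D≥0 : NonNeg D)
                 (φ : LCRM M k) where

  open Classes (labeledSetoid n k)

  -- φ is an arbitrary function of labeled sets, which need not respect pointwise equality, so it is
  -- applied not to labelsOf S itself but to a sample of D conditioned on agreeing with it pointwise.
  posterior : PSubset n k (suc c′) → Weighted (LabeledSet n k)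
  posterior S = D ∣ (labelsOf S ≈ᵇ_)

  labelMass : PSubset n k (suc c′) → ℚ
  labelMass S = classMass D (labelsOf S)

  -- The posterior has total weight labelMass S * labelMass S ⁻¹, i.e. 1, or 0 when labelMass S = 0;
  -- the empty set takes up the rest.
  ψ : PSubset n k (suc c′) → Weighted (PSubset n k (suc c′))
  ψ S = ((λ _ → false) , 1ℚ - labelMass S * labelMass S ⁻¹)
        ∷ bindWith (λ _ T → chosenCopies S T) (posterior S) (map-φ φ)

  ψ-total : ∀ S → sumℚ (map proj₂ (ψ S)) ≡ 1ℚ
  ψ-total S = begin
    (1ℚ - m * m ⁻¹) + sumℚ (map proj₂ (bindWith _ (posterior S) (map-φ φ)))
      ≡⟨ cong ((1ℚ - m * m ⁻¹) +_) (totalWeight≡𝔼1 (bindWith _ (posterior S) (map-φ φ))) ⟩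
    (1ℚ - m * m ⁻¹) + 𝔼 (bindWith _ (posterior S) (map-φ φ)) (λ _ → 1ℚ)
      ≡⟨ cong ((1ℚ - m * m ⁻¹) +_) (𝔼-bindWith _ (map-φ φ) (posterior S) _) ⟩
    (1ℚ - m * m ⁻¹) + 𝔼 (posterior S) (λ y → 𝔼 (map-φ φ y) (λ _ → 1ℚ))
      ≡⟨ cong ((1ℚ - m * m ⁻¹) +_) (𝔼-cong (posterior S) φ-total) ⟩
    (1ℚ - m * m ⁻¹) + 𝔼 (posterior S) (λ _ → 1ℚ)
      ≡⟨ cong ((1ℚ - m * m ⁻¹) +_) (𝔼-∣-1 D (labelsOf S ≈ᵇ_)) ⟩
    (1ℚ - m * m ⁻¹) + m * m ⁻¹
      ≡⟨ solve 1 (λ a → (con 1ℚ :- a) :+ a := con 1ℚ) refl (m * m ⁻¹) ⟩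
    1ℚ ∎
    where
    open ≡-Reasoning
    m : ℚ
    m = labelMass S
    φ-total : ∀ y → 𝔼 (map-φ φ y) (λ _ → 1ℚ) ≡ 1ℚ
    φ-total y = trans (sym (totalWeight≡𝔼1 (map-φ φ y))) (IsDist.total (isDist φ y))

  crm : CRM M k (suc c′)
  crm = record
    { map-ψ     = ψ
    ; isDist    = λ S → record
      { nonneg = 1-*⁻¹-nonNeg (labelMass S)
               ∷ bindWith-nonNeg _ (map-φ φ) (∣-nonNeg (labelsOf S ≈ᵇ_) D≥0) (IsDist.nonneg ∘ isDist φ)
      ; total  = ψ-total S
      }
    ; indep-out = λ S → ∅-indep M ∷ bindWith-All _ (map-φ φ) _ (posterior S)
                          (λ y → All.map (chosenCopies-indep M S) (indep-out φ y))
    ; sub-out   = λ S → (λ _ ()) ∷ bindWith-All _ (map-φ φ) _ (posterior S)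
                          (λ y → All.tabulate (λ {Tq} _ → chosenCopies-⊆ S (proj₁ Tq)))
    }

  keepProb : Fin n → Fin k → LabeledSet n k → ℚ
  keepProb e ℓ y = Pr (map-φ φ y) (λ T → lookup T e ∧ hasLabel y e ℓ)

  Pr-ψ-odot : ∀ x C e ℓ d → Pr (ψ (odot x C)) (λ T → T (e , ℓ , d))
                            ≡ 𝔼 (D ∣ (x ≈ᵇ_)) (keepProb e ℓ) * indicator ⌊ C e ≟ᶠ d ⌋
  Pr-ψ-odot x C e ℓ d = begin
    Pr (ψ S) (λ T → T (e , ℓ , d))
      ≡⟨ cong (_+ Pr copies (λ T → T (e , ℓ , d))) (*-zeroʳ (1ℚ - labelMass S * labelMass S ⁻¹)) ⟩
    0ℚ + Pr copies (λ T → T (e , ℓ , d))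
      ≡⟨ +-identityˡ _ ⟩
    Pr copies (λ T → T (e , ℓ , d))
      ≡⟨ 𝔼-bindWith _ (map-φ φ) (posterior S) _ ⟩
    𝔼 (posterior S) (λ y → Pr (map-φ φ y) (λ T → chosenCopies S T (e , ℓ , d)))
      ≡⟨ 𝔼-∣-cong D (≈ᵇ-respˡ (labelsOf-odot x C)) agree ⟩
    𝔼 (D ∣ (x ≈ᵇ_)) (λ y → keepProb e ℓ y * indicator ⌊ C e ≟ᶠ d ⌋)
      ≡⟨ 𝔼-*ʳ (D ∣ (x ≈ᵇ_)) _ (keepProb e ℓ) ⟩
    𝔼 (D ∣ (x ≈ᵇ_)) (keepProb e ℓ) * indicator ⌊ C e ≟ᶠ d ⌋ ∎
    where
    open ≡-Reasoning
    S : PSubset n k (suc c′)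
    S = odot x C
    copies : Weighted (PSubset n k (suc c′))
    copies = bindWith (λ _ T → chosenCopies S T) (posterior S) (map-φ φ)
    agree : ∀ y → labelsOf S ≈ᵇ y ≡ true → Pr (map-φ φ y) (λ T → chosenCopies S T (e , ℓ , d))
                                           ≡ keepProb e ℓ y * indicator ⌊ C e ≟ᶠ d ⌋
    agree y S≈y = trans (𝔼-cong (map-φ φ y) (cong indicator ∘ copy≡)) (Pr-∧ʳ (map-φ φ y) _ _)
      where
      xe≡ye : x e ≡ y e
      xe≡ye = trans (sym (labelsOf-odot x C e)) (≈ᵇ⇒≈ S≈y e)
      copy≡ : ∀ T → chosenCopies S T (e , ℓ , d) ≡ (lookup T e ∧ hasLabel y e ℓ) ∧ ⌊ C e ≟ᶠ d ⌋
      copy≡ T = begin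
        chosenCopies S T (e , ℓ , d)
          ≡⟨ chosenCopies-odot x C T e ℓ d ⟩
        lookup T e ∧ (hasLabel x e ℓ ∧ ⌊ C e ≟ᶠ d ⌋)
          ≡⟨ cong (λ b → lookup T e ∧ (b ∧ ⌊ C e ≟ᶠ d ⌋)) (hasLabel-resp {x = x} {y} e ℓ xe≡ye) ⟩
        lookup T e ∧ (hasLabel y e ℓ ∧ ⌊ C e ≟ᶠ d ⌋)
          ≡⟨ sym (∧-assoc (lookup T e) _ _) ⟩
        (lookup T e ∧ hasLabel y e ℓ) ∧ ⌊ C e ≟ᶠ d ⌋ ∎

  colourProb : Fin n → Fin (suc c′) → ℚ
  colourProb e d = Pr (uniformFuns n c′) (λ C → ⌊ C e ≟ᶠ d ⌋)

  Pr-odotDist : ∀ e ℓ d → Pr (odotDist c′ D) (λ S → S (e , ℓ , d))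
                          ≡ Pr D (λ x → hasLabel x e ℓ) * colourProb e d
  Pr-odotDist e ℓ d =
    trans (𝔼-odotDist D _)
    (trans (𝔼-cong D (λ x → Pr-∧ˡ (uniformFuns n c′) (hasLabel x e ℓ) _))
           (𝔼-*ʳ D (colourProb e d) _))

  𝔼-Pr-ψ : ∀ e ℓ d → 𝔼 (odotDist c′ D) (λ S → Pr (ψ S) (λ T → T (e , ℓ , d)))
                     ≡ 𝔼 D (keepProb e ℓ) * colourProb e d
  𝔼-Pr-ψ e ℓ d = begin
    𝔼 (odotDist c′ D) (λ S → Pr (ψ S) (λ T → T (e , ℓ , d)))
      ≡⟨ 𝔼-odotDist D _ ⟩
    𝔼 D (λ x → 𝔼 U (λ C → Pr (ψ (odot x C)) (λ T → T (e , ℓ , d))))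
      ≡⟨ 𝔼-cong D averageColour ⟩
    𝔼 D (λ x → 𝔼 (D ∣ (x ≈ᵇ_)) (keepProb e ℓ) * colourProb e d)
      ≡⟨ 𝔼-*ʳ D (colourProb e d) _ ⟩
    𝔼 D (λ x → 𝔼 (D ∣ (x ≈ᵇ_)) (keepProb e ℓ)) * colourProb e d
      ≡⟨ cong (_* colourProb e d) (𝔼-tower D D≥0 (keepProb e ℓ)) ⟩
    𝔼 D (keepProb e ℓ) * colourProb e d ∎
    where
    open ≡-Reasoning
    U : Weighted (Fin n → Fin (suc c′))
    U = uniformFuns n c′
    averageColour : ∀ x → 𝔼 U (λ C → Pr (ψ (odot x C)) (λ T → T (e , ℓ , d)))
                          ≡ 𝔼 (D ∣ (x ≈ᵇ_)) (keepProb e ℓ) * colourProb e d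
    averageColour x = trans (𝔼-cong U (λ C → Pr-ψ-odot x C e ℓ d))
                            (𝔼-*ˡ U (𝔼 (D ∣ (x ≈ᵇ_)) (keepProb e ℓ)) (λ C → indicator ⌊ C e ≟ᶠ d ⌋))

  balanced : ∀ α → LBalanced α D φ → Balanced α (odotDist c′ D) crm
  balanced α bal (e , ℓ , d) = begin
    α * Pr (odotDist c′ D) (λ S → S (e , ℓ , d))
      ≡⟨ cong (α *_) (Pr-odotDist e ℓ d) ⟩
    α * (Pr D (λ x → hasLabel x e ℓ) * colourProb e d)
      ≡⟨ sym (*-assoc α _ _) ⟩
    α * Pr D (λ x → hasLabel x e ℓ) * colourProb e d
      ≤⟨ *-monoʳ-≤-nonNeg (colourProb e d) {{colourProb≥0}} (bal e ℓ) ⟩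
    𝔼 D (keepProb e ℓ) * colourProb e d
      ≡⟨ sym (𝔼-Pr-ψ e ℓ d) ⟩
    𝔼 (odotDist c′ D) (λ S → Pr (ψ S) (λ T → T (e , ℓ , d))) ∎
    where
    open ≤-Reasoning
    colourProb≥0 : NonNegative (colourProb e d)
    colourProb≥0 =
      nonNegative (𝔼-nonNeg (uniformFuns-nonNeg n c′) (λ C → indicator-nonNeg ⌊ C e ≟ᶠ d ⌋))

mainTheorem8 : ∀ {n : ℕ} (M : Matroid n) (k c′ : ℕ) (α : ℚ)
                 (D : Weighted (LabeledSet n k)) →
                 IsDist D →
                 LUncontentious M k α D →
                 Uncontentious M k (suc c′) α (odotDist c′ D)
mainTheorem8 M k c′ α D D-dist (φ , bal) = crm , balanced α bal
  where open LiftedCRM {c′ = c′} M D (IsDist.nonneg D-dist) φ
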